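{- Let $a,b$ be positive odd integers and let $x$ be a complex number. Then for every nonnegative integer $m$, $$\sum_{i=0}^{m}\binom{m}{i}a^{i-1}b^{m-i}G_{i}(bx)S_{m-i}(a)=\sum_{i=0}^{m}\binom{m}{i}b^{i-1}a^{m-i}G_{i}(ax)S_{m-i}(b),$$ where $S_{k}(n)=\sum_{j=0}^{n-1}(-1)^{j}j^{k}$ (with $0^{0}=1$).
   Context: The ordinary Genocchi polynomials $G_n(x)$ are defined by the generating function $\sum_{n=0}^{\infty}G_{n}(x)\frac{t^{n}}{n!}=\frac{2t}{e^{t}+1}e^{xt}$. -}

module Defs where

open import Data.Nat as ℕ using (ℕ; zero; suc; _≟_)
open import Data.Nat.Combinatorics using (_C_)
open import Data.Integer using (+_)
open import Data.Rational using (ℚ; 0ℚ; 1ℚ; _+_; _*_; _-_; -_; ½; _/_)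
open import Relation.Nullary using (yes; no)
open import Relation.Binary.PropositionalEquality using (_≡_)
open import Data.Product using (Σ)

ℕ→ℚ : ℕ → ℚ
ℕ→ℚ n = + n / 1

_^ᵠ_ : ℚ → ℕ → ℚ
q ^ᵠ zero  = 1ℚ
q ^ᵠ suc k = q * (q ^ᵠ k)

-- reciprocal of a natural number (only used for positive arguments; 1/0 := 0)
recipℕ : ℕ → ℚ
recipℕ zero    = 0ℚ
recipℕ (suc n) = + 1 / suc n

-- a^(i-1) for i : ℕ, a positive natural (so a^(-1) = 1/a)
powPred : ℕ → ℕ → ℚ
powPred a zero    = recipℕ a
powPred a (suc i) = ℕ→ℚ a ^ᵠ i

Σ< : ℕ → (ℕ → ℚ) → ℚ
Σ< zero    f = 0ℚ
Σ< (suc n) f = Σ< n f + f n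

S : ℕ → ℕ → ℚ
S k n = Σ< n (λ j → ((- 1ℚ) ^ᵠ j) * (ℕ→ℚ j ^ᵠ k))

-- Genocchi numbers g_n = G_n(0): coefficients of 2t/(e^t+1) = Σ g_n t^n/n!.
-- Comparing coefficients of t^n/n! in (e^t + 1) Σ g_k t^k/k! = 2t gives
--   2 g_n + Σ_{k<n} C(n,k) g_k = 2 [n = 1].
δ₁ : ℕ → ℚ
δ₁ 1 = 1ℚ
δ₁ _ = 0ℚ

genNext : ℕ → (ℕ → ℚ) → ℚ
genNext n g = δ₁ n - ½ * Σ< n (λ k → ℕ→ℚ (n C k) * g k)

-- genUpTo n k = g_k for k < n (strong recursion)
genUpTo : ℕ → ℕ → ℚ
genUpTo zero    k = 0ℚ
genUpTo (suc n) k with k ≟ n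
... | yes _ = genNext n (genUpTo n)
... | no  _ = genUpTo n k

genocchiNumber : ℕ → ℚ
genocchiNumber n = genUpTo (suc n) n

-- Polynomials over ℚ in one variable x, as coefficient sequences (index = power of x)
Poly : Set
Poly = ℕ → ℚ

_+ₚ_ : Poly → Poly → Poly
(p +ₚ q) j = p j + q j

_·ₚ_ : ℚ → Poly → Poly
(c ·ₚ p) j = c * p j

0ₚ : Poly
0ₚ _ = 0ℚ

mono : ℚ → ℕ → Poly
mono c n j with j ≟ n
... | yes _ = c
... | no  _ = 0ℚ

Σₚ< : ℕ → (ℕ → Poly) → Poly
Σₚ< zero    f = 0ₚ
Σₚ< (suc n) f = Σₚ< n f +ₚ f n

scaleVar : ℚ → Poly → Poly
scaleVar c p j = (c ^ᵠ j) * p j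

-- Genocchi polynomials: 2t e^{xt}/(e^t+1) = Σ G_n(x) t^n/n!, hence
--   G_n(x) = Σ_{k=0}^{n} C(n,k) g_k x^{n-k}
genocchi : ℕ → Poly
genocchi n = Σₚ< (suc n) (λ k → mono (ℕ→ℚ (n C k) * genocchiNumber k) (n ℕ.∸ k))

PosOdd : ℕ → Set
PosOdd a = Σ ℕ (λ k → a ≡ suc (2 ℕ.* k))

-- Work with exponential generating functions. Let G(t) = 2t/(eᵗ+1) = Σ gₙ tⁿ/n! and
-- Sₐ(t) = Σₖ Sₖ(a) tᵏ/k! = Σ_{j<a} (-1)ʲ e^{jt}. For odd a the sum telescopes:
-- (eᵗ+1) Sₐ(t) = e^{at}+1. Hence (e^{at}+1)(e^{bt}+1) G(at) Sₐ(bt) = 2at (e^{abt}+1), and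
-- cancelling the invertible factors e^{at}+1 and e^{bt}+1 gives b G(at) Sₐ(bt) = a G(bt) S_b(at).
-- As Σᵢ Gᵢ(y) tⁱ/i! = G(t) e^{yt}, the left-hand side times a has generating function
-- e^{abxt} G(at) Sₐ(bt); multiplying the symmetry by e^{abxt} and comparing the coefficients
-- of xʲ tᵐ/m! proves the identity multiplied by ab.
module Submission where

open import Defs
open import Level using (0ℓ)
open import Data.Nat as ℕ using (ℕ; zero; suc; _∸_; _<_)
import Data.Nat.Properties as ℕ
open import Data.Nat.Induction using (<-rec)
open import Data.Nat.Combinatorics using (_C_; nCn≡1; k>n⇒nCk≡0; nCk+nC[k+1]≡[n+1]C[k+1])
import Data.Nat.Coprimality as Coprime
import Data.Integer as ℤ
import Data.Integer.Properties as ℤ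
open import Data.Rational using (ℚ; mkℚ; 0ℚ; 1ℚ; _+_; _*_; _-_; -_; ½; _/_; 1/_)
open import Data.Rational.Properties
open import Data.Product using (_,_)
open import Relation.Binary.PropositionalEquality
open import Relation.Nullary using (yes; no)
import Relation.Nullary.Decidable as Dec
open import Data.Empty using (⊥-elim)
open import Tactic.RingSolver using (solve-∀)
open import Tactic.RingSolver.Core.AlmostCommutativeRing using (AlmostCommutativeRing; fromCommutativeRing)
open import Algebra.Bundles using (CommutativeRing)
open import Algebra.Properties.Group +-0-group using () renaming (∙-cancelˡ to +-cancelˡ)
import Algebra.Properties.CommutativeSemigroup as CommSemigroupProperties
open CommSemigroupProperties (CommutativeRing.+-commutativeSemigroup +-*-commutativeRing)
  using () renaming (interchange to +-interchange; x∙yz≈y∙xz to x+[y+z]≡y+[x+z])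
open CommSemigroupProperties (CommutativeRing.*-commutativeSemigroup +-*-commutativeRing)
  using () renaming (interchange to *-interchange; x∙yz≈y∙xz to x*[y*z]≡y*[x*z])
open ≡-Reasoning

ℚ-ring : AlmostCommutativeRing 0ℓ 0ℓ
ℚ-ring = fromCommutativeRing +-*-commutativeRing (λ x → Dec.dec⇒maybe (0ℚ ≟ x))

*-cancelˡ-invertible : ∀ {p r} → r * p ≡ 1ℚ → ∀ x y → p * x ≡ p * y → x ≡ y
*-cancelˡ-invertible {p} {r} r*p≡1 x y p*x≡p*y = begin
  x             ≡⟨ sym (cancel x) ⟩
  r * (p * x)   ≡⟨ cong (r *_) p*x≡p*y ⟩
  r * (p * y)   ≡⟨ cancel y ⟩
  y             ∎
  where
  cancel : ∀ z → r * (p * z) ≡ z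
  cancel z = trans (sym (*-assoc r p z)) (trans (cong (_* z) r*p≡1) (*-identityˡ z))

ℕ→ℚ≡mkℚ : ∀ n → ℕ→ℚ n ≡ mkℚ (ℤ.+ n) 0 (Coprime.sym (Coprime.1-coprimeTo n))
ℕ→ℚ≡mkℚ n = normalize-coprime (Coprime.sym (Coprime.1-coprimeTo n))

ℕ→ℚ-homo-+ : ∀ m n → ℕ→ℚ (m ℕ.+ n) ≡ ℕ→ℚ m + ℕ→ℚ n
ℕ→ℚ-homo-+ m n = begin
  ℤ.+ (m ℕ.+ n) / 1
    ≡⟨ cong (_/ 1) (sym (cong₂ ℤ._+_ (ℤ.*-identityʳ (ℤ.+ m)) (ℤ.*-identityʳ (ℤ.+ n)))) ⟩
  (ℤ.+ m ℤ.* ℤ.+ 1 ℤ.+ ℤ.+ n ℤ.* ℤ.+ 1) / 1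
    ≡⟨ sym (cong₂ _+_ (ℕ→ℚ≡mkℚ m) (ℕ→ℚ≡mkℚ n)) ⟩
  ℕ→ℚ m + ℕ→ℚ n ∎

recipℕ-inverse : ∀ a .{{_ : ℕ.NonZero a}} → recipℕ a * ℕ→ℚ a ≡ 1ℚ
recipℕ-inverse (suc n) = begin
  recipℕ (suc n) * ℕ→ℚ (suc n)    ≡⟨ cong₂ _*_ (normalize-coprime (Coprime.1-coprimeTo (suc n))) (ℕ→ℚ≡mkℚ (suc n)) ⟩
  1/ q * q                          ≡⟨ *-inverseˡ q ⟩
  1ℚ                                ∎
  where q = mkℚ (ℤ.+ suc n) 0 (Coprime.sym (Coprime.1-coprimeTo (suc n)))

ℕ→ℚ-*-cancelˡ : ∀ a .{{_ : ℕ.NonZero a}} x y → ℕ→ℚ a * x ≡ ℕ→ℚ a * y → x ≡ y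
ℕ→ℚ-*-cancelˡ a = *-cancelˡ-invertible {ℕ→ℚ a} {recipℕ a} (recipℕ-inverse a)

^ᵠ-distribˡ-+-* : ∀ c m n → c ^ᵠ (m ℕ.+ n) ≡ c ^ᵠ m * c ^ᵠ n
^ᵠ-distribˡ-+-* c zero    n = sym (*-identityˡ (c ^ᵠ n))
^ᵠ-distribˡ-+-* c (suc m) n = trans (cong (c *_) (^ᵠ-distribˡ-+-* c m n)) (sym (*-assoc c (c ^ᵠ m) (c ^ᵠ n)))

^ᵠ-distribʳ-* : ∀ c d n → (c * d) ^ᵠ n ≡ c ^ᵠ n * d ^ᵠ n
^ᵠ-distribʳ-* c d zero    = refl
^ᵠ-distribʳ-* c d (suc n) = trans (cong ((c * d) *_) (^ᵠ-distribʳ-* c d n)) (*-interchange c d (c ^ᵠ n) (d ^ᵠ n))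

1^ᵠn≡1 : ∀ n → 1ℚ ^ᵠ n ≡ 1ℚ
1^ᵠn≡1 zero    = refl
1^ᵠn≡1 (suc n) = trans (*-identityˡ (1ℚ ^ᵠ n)) (1^ᵠn≡1 n)

0^ᵠ[m∸n]≡0 : ∀ {m n} → n < m → 0ℚ ^ᵠ (m ∸ n) ≡ 0ℚ
0^ᵠ[m∸n]≡0 {m} {n} n<m = begin
  0ℚ ^ᵠ (m ∸ n)            ≡⟨ cong (0ℚ ^ᵠ_) (ℕ.+-∸-assoc 1 n<m) ⟩
  0ℚ * 0ℚ ^ᵠ (m ∸ suc n)   ≡⟨ *-zeroˡ (0ℚ ^ᵠ (m ∸ suc n)) ⟩
  0ℚ                        ∎

[-1]^ᵠodd≡-1 : ∀ {a} → PosOdd a → (- 1ℚ) ^ᵠ a ≡ - 1ℚ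
[-1]^ᵠodd≡-1 (k , refl) = begin
  - 1ℚ * (- 1ℚ) ^ᵠ (k ℕ.+ (k ℕ.+ 0))      ≡⟨ cong (λ e → - 1ℚ * (- 1ℚ) ^ᵠ (k ℕ.+ e)) (ℕ.+-identityʳ k) ⟩
  - 1ℚ * (- 1ℚ) ^ᵠ (k ℕ.+ k)              ≡⟨ cong (- 1ℚ *_) (^ᵠ-distribˡ-+-* (- 1ℚ) k k) ⟩
  - 1ℚ * ((- 1ℚ) ^ᵠ k * (- 1ℚ) ^ᵠ k)     ≡⟨ cong (- 1ℚ *_) (sym (^ᵠ-distribʳ-* (- 1ℚ) (- 1ℚ) k)) ⟩
  - 1ℚ * 1ℚ ^ᵠ k                          ≡⟨ cong (- 1ℚ *_) (1^ᵠn≡1 k) ⟩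
  - 1ℚ * 1ℚ                               ≡⟨ *-identityʳ (- 1ℚ) ⟩
  - 1ℚ                                    ∎

*-powPred : ∀ a .{{_ : ℕ.NonZero a}} i → ℕ→ℚ a * powPred a i ≡ ℕ→ℚ a ^ᵠ i
*-powPred a zero    = trans (*-comm (ℕ→ℚ a) (recipℕ a)) (recipℕ-inverse a)
*-powPred a (suc i) = refl

Σ<-cong : ∀ n {f g : ℕ → ℚ} → (∀ k → k < n → f k ≡ g k) → Σ< n f ≡ Σ< n g
Σ<-cong zero    f≡g = refl
Σ<-cong (suc n) f≡g = cong₂ _+_ (Σ<-cong n (λ k k<n → f≡g k (ℕ.m<n⇒m<1+n k<n))) (f≡g n (ℕ.n<1+n n))

Σ<-zero : ∀ n {f : ℕ → ℚ} → (∀ k → k < n → f k ≡ 0ℚ) → Σ< n f ≡ 0ℚ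
Σ<-zero zero    f≡0 = refl
Σ<-zero (suc n) f≡0 = cong₂ _+_ (Σ<-zero n (λ k k<n → f≡0 k (ℕ.m<n⇒m<1+n k<n))) (f≡0 n (ℕ.n<1+n n))

Σ<-distrib-+ : ∀ n (f g : ℕ → ℚ) → Σ< n (λ k → f k + g k) ≡ Σ< n f + Σ< n g
Σ<-distrib-+ zero    f g = refl
Σ<-distrib-+ (suc n) f g =
  trans (cong (_+ (f n + g n)) (Σ<-distrib-+ n f g)) (+-interchange (Σ< n f) (Σ< n g) (f n) (g n))

*-distribˡ-Σ< : ∀ n c (f : ℕ → ℚ) → c * Σ< n f ≡ Σ< n (λ k → c * f k)
*-distribˡ-Σ< zero    c f = *-zeroʳ c
*-distribˡ-Σ< (suc n) c f = trans (*-distribˡ-+ c (Σ< n f) (f n)) (cong (_+ c * f n) (*-distribˡ-Σ< n c f))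

Σ<-head : ∀ n (f : ℕ → ℚ) → Σ< (suc n) f ≡ f 0 + Σ< n (λ k → f (suc k))
Σ<-head zero    f = trans (+-identityˡ (f 0)) (sym (+-identityʳ (f 0)))
Σ<-head (suc n) f = trans (cong (_+ f (suc n)) (Σ<-head n f)) (+-assoc (f 0) _ (f (suc n)))

Σₚ<-apply : ∀ n (F : ℕ → Poly) j → Σₚ< n F j ≡ Σ< n (λ i → F i j)
Σₚ<-apply zero    F j = refl
Σₚ<-apply (suc n) F j = cong (_+ F n j) (Σₚ<-apply n F j)

_Cℚ_ : ℕ → ℕ → ℚ
n Cℚ k = ℕ→ℚ (n C k)

-- A sequence f stands for the exponential generating function Σ f n tⁿ/n!:
-- _⋆_ is their product, D the derivative d/dt, and scaleVar c the substitution t ↦ c t.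
EGF : Set
EGF = ℕ → ℚ

infixl 25 _⋆_
_⋆_ : EGF → EGF → EGF
(f ⋆ g) n = Σ< (suc n) (λ k → n Cℚ k * f k * g (n ∸ k))

D : EGF → EGF
D f n = f (suc n)

⋆-cong : ∀ {f f′ g g′ : EGF} → f ≗ f′ → g ≗ g′ → f ⋆ g ≗ f′ ⋆ g′
⋆-cong f≗f′ g≗g′ n = Σ<-cong (suc n) (λ k _ → cong₂ (λ x y → n Cℚ k * x * y) (f≗f′ k) (g≗g′ (n ∸ k)))

⋆-last : ∀ f g n → (f ⋆ g) n ≡ Σ< n (λ k → n Cℚ k * f k * g (n ∸ k)) + f n * g 0
⋆-last f g n = cong (Σ< n (λ k → n Cℚ k * f k * g (n ∸ k)) +_) (begin
  n Cℚ n * f n * g (n ∸ n)   ≡⟨ cong₂ (λ c e → ℕ→ℚ c * f n * g e) (nCn≡1 n) (ℕ.n∸n≡0 n) ⟩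
  1ℚ * f n * g 0             ≡⟨ cong (_* g 0) (*-identityˡ (f n)) ⟩
  f n * g 0                  ∎)

⋆-at-0 : ∀ f g → (f ⋆ g) 0 ≡ f 0 * g 0
⋆-at-0 f g = trans (⋆-last f g 0) (+-identityˡ (f 0 * g 0))

leibniz : ∀ f g n → (f ⋆ g) (suc n) ≡ (D f ⋆ g) n + (f ⋆ D g) n
leibniz f g n = begin
  (f ⋆ g) (suc n)                                 ≡⟨ Σ<-head (suc n) _ ⟩
  head + Σ< (suc n) (λ k → suc n Cℚ suc k * f (suc k) * g (n ∸ k))
    ≡⟨ cong (head +_) (trans (Σ<-cong (suc n) (λ k _ → pascal k)) (Σ<-distrib-+ (suc n) _ _)) ⟩
  head + ((D f ⋆ g) n + tail)                     ≡⟨ x+[y+z]≡y+[x+z] head ((D f ⋆ g) n) tail ⟩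
  (D f ⋆ g) n + (head + tail)                     ≡⟨ cong ((D f ⋆ g) n +_) (sym f⋆Dg≡head+tail) ⟩
  (D f ⋆ g) n + (f ⋆ D g) n                       ∎
  where
  head = n Cℚ 0 * f 0 * g (suc n)
  term : ℕ → ℚ
  term k = n Cℚ suc k * f (suc k) * g (n ∸ k)
  tail = Σ< (suc n) term

  pascal : ∀ k → suc n Cℚ suc k * f (suc k) * g (n ∸ k) ≡ n Cℚ k * f (suc k) * g (n ∸ k) + term k
  pascal k = begin
    suc n Cℚ suc k * f (suc k) * g (n ∸ k)
      ≡⟨ cong (λ c → c * f (suc k) * g (n ∸ k)) (trans (cong ℕ→ℚ (sym (nCk+nC[k+1]≡[n+1]C[k+1] n k))) (ℕ→ℚ-homo-+ (n C k) (n C suc k))) ⟩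
    (n Cℚ k + n Cℚ suc k) * f (suc k) * g (n ∸ k)
      ≡⟨ cong (_* g (n ∸ k)) (*-distribʳ-+ (f (suc k)) (n Cℚ k) (n Cℚ suc k)) ⟩
    (n Cℚ k * f (suc k) + n Cℚ suc k * f (suc k)) * g (n ∸ k)
      ≡⟨ *-distribʳ-+ (g (n ∸ k)) (n Cℚ k * f (suc k)) (n Cℚ suc k * f (suc k)) ⟩
    n Cℚ k * f (suc k) * g (n ∸ k) + term k ∎

  last≡0 : term n ≡ 0ℚ
  last≡0 = begin
    ℕ→ℚ (n C suc n) * f (suc n) * g (n ∸ n)   ≡⟨ cong (λ c → ℕ→ℚ c * f (suc n) * g (n ∸ n)) (k>n⇒nCk≡0 (ℕ.n<1+n n)) ⟩
    0ℚ * f (suc n) * g (n ∸ n)                 ≡⟨ cong (_* g (n ∸ n)) (*-zeroˡ (f (suc n))) ⟩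
    0ℚ * g (n ∸ n)                             ≡⟨ *-zeroˡ (g (n ∸ n)) ⟩
    0ℚ                                         ∎

  f⋆Dg≡head+tail : (f ⋆ D g) n ≡ head + tail
  f⋆Dg≡head+tail = begin
    (f ⋆ D g) n                                                          ≡⟨ Σ<-head n _ ⟩
    head + Σ< n (λ k → n Cℚ suc k * f (suc k) * g (suc (n ∸ suc k)))
      ≡⟨ cong (head +_) (Σ<-cong n (λ k k<n → cong (λ e → n Cℚ suc k * f (suc k) * g e) (sym (ℕ.+-∸-assoc 1 k<n)))) ⟩
    head + Σ< n term                                                     ≡⟨ cong (head +_) (sym (+-identityʳ (Σ< n term))) ⟩
    head + (Σ< n term + 0ℚ)                                              ≡⟨ cong (λ z → head + (Σ< n term + z)) (sym last≡0) ⟩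
    head + tail                                                          ∎

⋆-distribʳ-+ₚ : ∀ f g h → (f +ₚ g) ⋆ h ≗ f ⋆ h +ₚ g ⋆ h
⋆-distribʳ-+ₚ f g h n = trans (Σ<-cong (suc n) (λ k _ → distrib (n Cℚ k) (f k) (g k) (h (n ∸ k)))) (Σ<-distrib-+ (suc n) _ _)
  where
  distrib : ∀ c x y z → c * (x + y) * z ≡ c * x * z + c * y * z
  distrib = solve-∀ ℚ-ring

⋆-distribˡ-+ₚ : ∀ f g h → f ⋆ (g +ₚ h) ≗ f ⋆ g +ₚ f ⋆ h
⋆-distribˡ-+ₚ f g h n = trans (Σ<-cong (suc n) (λ k _ → *-distribˡ-+ (n Cℚ k * f k) (g (n ∸ k)) (h (n ∸ k)))) (Σ<-distrib-+ (suc n) _ _)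

⋆-·ₚˡ : ∀ c f g → (c ·ₚ f) ⋆ g ≗ c ·ₚ (f ⋆ g)
⋆-·ₚˡ c f g n = trans (Σ<-cong (suc n) (λ k _ → pull (n Cℚ k) c (f k) (g (n ∸ k)))) (sym (*-distribˡ-Σ< (suc n) c _))
  where
  pull : ∀ b c x y → b * (c * x) * y ≡ c * (b * x * y)
  pull = solve-∀ ℚ-ring

⋆-·ₚʳ : ∀ c f g → f ⋆ (c ·ₚ g) ≗ c ·ₚ (f ⋆ g)
⋆-·ₚʳ c f g n = trans (Σ<-cong (suc n) (λ k _ → pull (n Cℚ k) c (f k) (g (n ∸ k)))) (sym (*-distribˡ-Σ< (suc n) c _))
  where
  pull : ∀ b c x y → b * x * (c * y) ≡ c * (b * x * y)
  pull = solve-∀ ℚ-ring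

⋆-zeroʳ : ∀ f → f ⋆ 0ₚ ≗ 0ₚ
⋆-zeroʳ f n = Σ<-zero (suc n) (λ k _ → *-zeroʳ (n Cℚ k * f k))

⋆-comm : ∀ f g → f ⋆ g ≗ g ⋆ f
⋆-comm f g zero    = begin
  (f ⋆ g) 0    ≡⟨ ⋆-at-0 f g ⟩
  f 0 * g 0    ≡⟨ *-comm (f 0) (g 0) ⟩
  g 0 * f 0    ≡⟨ sym (⋆-at-0 g f) ⟩
  (g ⋆ f) 0    ∎
⋆-comm f g (suc n) = begin
  (f ⋆ g) (suc n)                    ≡⟨ leibniz f g n ⟩
  (D f ⋆ g) n + (f ⋆ D g) n          ≡⟨ cong₂ _+_ (⋆-comm (D f) g n) (⋆-comm f (D g) n) ⟩
  (g ⋆ D f) n + (D g ⋆ f) n          ≡⟨ +-comm ((g ⋆ D f) n) ((D g ⋆ f) n) ⟩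
  (D g ⋆ f) n + (g ⋆ D f) n          ≡⟨ sym (leibniz g f n) ⟩
  (g ⋆ f) (suc n)                    ∎

⋆-assoc : ∀ f g h → (f ⋆ g) ⋆ h ≗ f ⋆ (g ⋆ h)
⋆-assoc f g h zero    = begin
  ((f ⋆ g) ⋆ h) 0      ≡⟨ ⋆-at-0 (f ⋆ g) h ⟩
  (f ⋆ g) 0 * h 0      ≡⟨ cong (_* h 0) (⋆-at-0 f g) ⟩
  f 0 * g 0 * h 0      ≡⟨ *-assoc (f 0) (g 0) (h 0) ⟩
  f 0 * (g 0 * h 0)    ≡⟨ cong (f 0 *_) (sym (⋆-at-0 g h)) ⟩
  f 0 * (g ⋆ h) 0      ≡⟨ sym (⋆-at-0 f (g ⋆ h)) ⟩
  (f ⋆ (g ⋆ h)) 0      ∎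
⋆-assoc f g h (suc n) = begin
  ((f ⋆ g) ⋆ h) (suc n)
    ≡⟨ leibniz (f ⋆ g) h n ⟩
  (D (f ⋆ g) ⋆ h) n + ((f ⋆ g) ⋆ D h) n
    ≡⟨ cong (_+ ((f ⋆ g) ⋆ D h) n) (trans (⋆-cong {g = h} (leibniz f g) (λ _ → refl) n) (⋆-distribʳ-+ₚ (D f ⋆ g) (f ⋆ D g) h n)) ⟩
  (((D f ⋆ g) ⋆ h) n + ((f ⋆ D g) ⋆ h) n) + ((f ⋆ g) ⋆ D h) n
    ≡⟨ cong₂ _+_ (cong₂ _+_ (⋆-assoc (D f) g h n) (⋆-assoc f (D g) h n)) (⋆-assoc f g (D h) n) ⟩
  ((D f ⋆ (g ⋆ h)) n + (f ⋆ (D g ⋆ h)) n) + (f ⋆ (g ⋆ D h)) n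
    ≡⟨ +-assoc ((D f ⋆ (g ⋆ h)) n) ((f ⋆ (D g ⋆ h)) n) ((f ⋆ (g ⋆ D h)) n) ⟩
  (D f ⋆ (g ⋆ h)) n + ((f ⋆ (D g ⋆ h)) n + (f ⋆ (g ⋆ D h)) n)
    ≡⟨ cong ((D f ⋆ (g ⋆ h)) n +_) (trans (sym (⋆-distribˡ-+ₚ f (D g ⋆ h) (g ⋆ D h) n)) (⋆-cong {f = f} (λ _ → refl) (λ k → sym (leibniz g h k)) n)) ⟩
  (D f ⋆ (g ⋆ h)) n + (f ⋆ D (g ⋆ h)) n
    ≡⟨ sym (leibniz f (g ⋆ h) n) ⟩
  (f ⋆ (g ⋆ h)) (suc n) ∎

⋆-exchange : ∀ f g h → f ⋆ (g ⋆ h) ≗ g ⋆ (f ⋆ h)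
⋆-exchange f g h n = begin
  (f ⋆ (g ⋆ h)) n    ≡⟨ sym (⋆-assoc f g h n) ⟩
  ((f ⋆ g) ⋆ h) n    ≡⟨ ⋆-cong {g = h} (⋆-comm f g) (λ _ → refl) n ⟩
  ((g ⋆ f) ⋆ h) n    ≡⟨ ⋆-assoc g f h n ⟩
  (g ⋆ (f ⋆ h)) n    ∎

⋆-cancelˡ : ∀ {h r} → r * h 0 ≡ 1ℚ → ∀ {f f′} → h ⋆ f ≗ h ⋆ f′ → f ≗ f′
⋆-cancelˡ {h} {r} r*h0≡1 {f} {f′} h⋆f≗h⋆f′ = <-rec (λ n → f n ≡ f′ n) step
  where
  step : ∀ n → (∀ {k} → k < n → f k ≡ f′ k) → f n ≡ f′ n
  step n below = *-cancelˡ-invertible {h 0} {r} r*h0≡1 (f n) (f′ n) (begin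
    h 0 * f n     ≡⟨ *-comm (h 0) (f n) ⟩
    f n * h 0     ≡⟨ +-cancelˡ lower (f n * h 0) (f′ n * h 0) top ⟩
    f′ n * h 0    ≡⟨ *-comm (f′ n) (h 0) ⟩
    h 0 * f′ n    ∎)
    where
    lower = Σ< n (λ k → n Cℚ k * f k * h (n ∸ k))

    top : lower + f n * h 0 ≡ lower + f′ n * h 0
    top = begin
      lower + f n * h 0                                       ≡⟨ sym (⋆-last f h n) ⟩
      (f ⋆ h) n                                               ≡⟨ ⋆-comm f h n ⟩
      (h ⋆ f) n                                               ≡⟨ h⋆f≗h⋆f′ n ⟩
      (h ⋆ f′) n                                              ≡⟨ ⋆-comm h f′ n ⟩
      (f′ ⋆ h) n                                              ≡⟨ ⋆-last f′ h n ⟩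
      Σ< n (λ k → n Cℚ k * f′ k * h (n ∸ k)) + f′ n * h 0
        ≡⟨ cong (_+ f′ n * h 0) (Σ<-cong n (λ k k<n → cong (λ x → n Cℚ k * x * h (n ∸ k)) (sym (below k<n)))) ⟩
      lower + f′ n * h 0                                      ∎

exp : ℚ → EGF
exp c n = c ^ᵠ n

exp-⋆ : ∀ c d → exp c ⋆ exp d ≗ exp (c + d)
exp-⋆ c d zero    = refl
exp-⋆ c d (suc n) = begin
  (exp c ⋆ exp d) (suc n)                             ≡⟨ leibniz (exp c) (exp d) n ⟩
  (D (exp c) ⋆ exp d) n + (exp c ⋆ D (exp d)) n       ≡⟨ cong₂ _+_ (⋆-·ₚˡ c (exp c) (exp d) n) (⋆-·ₚʳ d (exp c) (exp d) n) ⟩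
  c * (exp c ⋆ exp d) n + d * (exp c ⋆ exp d) n       ≡⟨ sym (*-distribʳ-+ ((exp c ⋆ exp d) n) c d) ⟩
  (c + d) * (exp c ⋆ exp d) n                         ≡⟨ cong ((c + d) *_) (exp-⋆ c d n) ⟩
  exp (c + d) (suc n)                                 ∎

exp+1 : ℚ → EGF
exp+1 c = exp c +ₚ exp 0ℚ

exp+1-⋆-cancelˡ : ∀ c {f f′} → exp+1 c ⋆ f ≗ exp+1 c ⋆ f′ → f ≗ f′
exp+1-⋆-cancelˡ c = ⋆-cancelˡ {r = ½} refl

twoT : EGF
twoT n = δ₁ n + δ₁ n

scaleVar-cong : ∀ c {f g} → f ≗ g → scaleVar c f ≗ scaleVar c g
scaleVar-cong c f≗g n = cong (c ^ᵠ n *_) (f≗g n)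

scaleVar-scaleVar : ∀ c d f → scaleVar c (scaleVar d f) ≗ scaleVar (c * d) f
scaleVar-scaleVar c d f n = trans (sym (*-assoc (c ^ᵠ n) (d ^ᵠ n) (f n))) (cong (_* f n) (sym (^ᵠ-distribʳ-* c d n)))

scaleVar-⋆ : ∀ c f g → scaleVar c (f ⋆ g) ≗ scaleVar c f ⋆ scaleVar c g
scaleVar-⋆ c f g n = trans (*-distribˡ-Σ< (suc n) (c ^ᵠ n) _) (Σ<-cong (suc n) (λ k k≤n → begin
  c ^ᵠ n * (n Cℚ k * f k * g (n ∸ k))
    ≡⟨ cong (λ e → c ^ᵠ e * (n Cℚ k * f k * g (n ∸ k))) (sym (ℕ.m+[n∸m]≡n (ℕ.≤-pred k≤n))) ⟩
  c ^ᵠ (k ℕ.+ (n ∸ k)) * (n Cℚ k * f k * g (n ∸ k))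
    ≡⟨ cong (_* (n Cℚ k * f k * g (n ∸ k))) (^ᵠ-distribˡ-+-* c k (n ∸ k)) ⟩
  (c ^ᵠ k * c ^ᵠ (n ∸ k)) * (n Cℚ k * f k * g (n ∸ k))
    ≡⟨ distribute (c ^ᵠ k) (c ^ᵠ (n ∸ k)) (n Cℚ k) (f k) (g (n ∸ k)) ⟩
  n Cℚ k * (c ^ᵠ k * f k) * (c ^ᵠ (n ∸ k) * g (n ∸ k)) ∎))
  where
  distribute : ∀ p q b x y → (p * q) * (b * x * y) ≡ b * (p * x) * (q * y)
  distribute = solve-∀ ℚ-ring

scaleVar-exp : ∀ c d → scaleVar c (exp d) ≗ exp (c * d)
scaleVar-exp c d n = sym (^ᵠ-distribʳ-* c d n)

scaleVar-exp+1 : ∀ c d → scaleVar c (exp+1 d) ≗ exp+1 (c * d)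
scaleVar-exp+1 c d n = begin
  c ^ᵠ n * (exp d n + exp 0ℚ n)              ≡⟨ *-distribˡ-+ (c ^ᵠ n) (exp d n) (exp 0ℚ n) ⟩
  c ^ᵠ n * exp d n + c ^ᵠ n * exp 0ℚ n       ≡⟨ cong₂ _+_ (scaleVar-exp c d n) (scaleVar-exp c 0ℚ n) ⟩
  exp (c * d) n + exp (c * 0ℚ) n             ≡⟨ cong (λ z → exp (c * d) n + exp z n) (*-zeroʳ c) ⟩
  exp+1 (c * d) n                            ∎

scaleVar-twoT : ∀ c → scaleVar c twoT ≗ c ·ₚ twoT
scaleVar-twoT c zero          = trans (*-zeroʳ 1ℚ) (sym (*-zeroʳ c))
scaleVar-twoT c (suc zero)    = cong (_* twoT 1) (*-identityʳ c)
scaleVar-twoT c (suc (suc n)) = trans (*-zeroʳ (c ^ᵠ suc (suc n))) (sym (*-zeroʳ c))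

genocchiNumber-unfold : ∀ n → genocchiNumber n ≡ genNext n (genUpTo n)
genocchiNumber-unfold n with n ℕ.≟ n
... | yes _  = refl
... | no n≢n = ⊥-elim (n≢n refl)

genUpTo-stable : ∀ {n k} → k < n → genUpTo n k ≡ genocchiNumber k
genUpTo-stable {suc n} {k} k<1+n with k ℕ.≟ n
... | yes refl = sym (genocchiNumber-unfold k)
... | no k≢n   = genUpTo-stable (ℕ.≤∧≢⇒< (ℕ.≤-pred k<1+n) k≢n)

genocchiNumber-rec : ∀ n → genocchiNumber n ≡ δ₁ n - ½ * Σ< n (λ k → n Cℚ k * genocchiNumber k)
genocchiNumber-rec n = trans (genocchiNumber-unfold n)
  (cong (λ s → δ₁ n - ½ * s) (Σ<-cong n (λ k k<n → cong (n Cℚ k *_) (genUpTo-stable k<n))))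

genocchiNumber-⋆-exp+1 : genocchiNumber ⋆ exp+1 1ℚ ≗ twoT
genocchiNumber-⋆-exp+1 n = begin
  (g ⋆ exp+1 1ℚ) n                                           ≡⟨ ⋆-distribˡ-+ₚ g (exp 1ℚ) (exp 0ℚ) n ⟩
  (g ⋆ exp 1ℚ) n + (g ⋆ exp 0ℚ) n                            ≡⟨ cong₂ _+_ (⋆-last g (exp 1ℚ) n) (⋆-last g (exp 0ℚ) n) ⟩
  (Σ< n (term 1ℚ) + g n * 1ℚ) + (Σ< n (term 0ℚ) + g n * 1ℚ)  ≡⟨ cong₂ (λ x y → (x + g n * 1ℚ) + (y + g n * 1ℚ)) sum₁ sum₀ ⟩
  (s + g n * 1ℚ) + (0ℚ + g n * 1ℚ)                           ≡⟨ cong (λ x → (s + x * 1ℚ) + (0ℚ + x * 1ℚ)) (genocchiNumber-rec n) ⟩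
  (s + (δ₁ n - ½ * s) * 1ℚ) + (0ℚ + (δ₁ n - ½ * s) * 1ℚ)     ≡⟨ simplify s (δ₁ n) ⟩
  twoT n                                                     ∎
  where
  g = genocchiNumber
  term : ℚ → ℕ → ℚ
  term c k = n Cℚ k * g k * c ^ᵠ (n ∸ k)
  s = Σ< n (λ k → n Cℚ k * g k)

  sum₁ : Σ< n (term 1ℚ) ≡ s
  sum₁ = Σ<-cong n (λ k _ → trans (cong (n Cℚ k * g k *_) (1^ᵠn≡1 (n ∸ k))) (*-identityʳ (n Cℚ k * g k)))

  sum₀ : Σ< n (term 0ℚ) ≡ 0ℚ
  sum₀ = Σ<-zero n (λ k k<n → trans (cong (n Cℚ k * g k *_) (0^ᵠ[m∸n]≡0 k<n)) (*-zeroʳ (n Cℚ k * g k)))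

  simplify : ∀ s d → (s + (d - ½ * s) * 1ℚ) + (0ℚ + (d - ½ * s) * 1ℚ) ≡ d + d
  simplify = solve-∀ ℚ-ring

altPowerSums : ℕ → EGF
altPowerSums a k = S k a

exp+1-⋆-exp : ∀ d → exp+1 1ℚ ⋆ exp d ≗ exp (1ℚ + d) +ₚ exp d
exp+1-⋆-exp d n = begin
  (exp+1 1ℚ ⋆ exp d) n                       ≡⟨ ⋆-distribʳ-+ₚ (exp 1ℚ) (exp 0ℚ) (exp d) n ⟩
  (exp 1ℚ ⋆ exp d) n + (exp 0ℚ ⋆ exp d) n    ≡⟨ cong₂ _+_ (exp-⋆ 1ℚ d n) (exp-⋆ 0ℚ d n) ⟩
  exp (1ℚ + d) n + exp (0ℚ + d) n            ≡⟨ cong (λ c → exp (1ℚ + d) n + exp c n) (+-identityˡ d) ⟩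
  exp (1ℚ + d) n + exp d n                   ∎

exp+1-⋆-altPowerSums : ∀ a → exp+1 1ℚ ⋆ altPowerSums a ≗ λ n → exp 0ℚ n - (- 1ℚ) ^ᵠ a * exp (ℕ→ℚ a) n
exp+1-⋆-altPowerSums zero    n = trans (⋆-zeroʳ (exp+1 1ℚ) n)
  (sym (trans (cong (λ x → exp 0ℚ n - x) (*-identityˡ (exp 0ℚ n))) (+-inverseʳ (exp 0ℚ n))))
exp+1-⋆-altPowerSums (suc a) n = begin
  (exp+1 1ℚ ⋆ altPowerSums (suc a)) n
    ≡⟨ ⋆-distribˡ-+ₚ (exp+1 1ℚ) (altPowerSums a) (σ ·ₚ exp A) n ⟩
  (exp+1 1ℚ ⋆ altPowerSums a) n + (exp+1 1ℚ ⋆ (σ ·ₚ exp A)) n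
    ≡⟨ cong₂ _+_ (exp+1-⋆-altPowerSums a n) (trans (⋆-·ₚʳ σ (exp+1 1ℚ) (exp A) n) (cong (σ *_) (exp+1-⋆-exp A n))) ⟩
  (exp 0ℚ n - σ * exp A n) + σ * (exp (1ℚ + A) n + exp A n)
    ≡⟨ telescope (exp 0ℚ n) σ (exp A n) (exp (1ℚ + A) n) ⟩
  exp 0ℚ n - (- 1ℚ * σ) * exp (1ℚ + A) n
    ≡⟨ cong (λ c → exp 0ℚ n - (- 1ℚ * σ) * exp c n) (sym (ℕ→ℚ-homo-+ 1 a)) ⟩
  exp 0ℚ n - (- 1ℚ) ^ᵠ suc a * exp (ℕ→ℚ (suc a)) n ∎
  where
  σ = (- 1ℚ) ^ᵠ a
  A = ℕ→ℚ a
  telescope : ∀ z s x y → (z - s * x) + s * (y + x) ≡ z - (- 1ℚ * s) * y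
  telescope = solve-∀ ℚ-ring

exp+1-⋆-altPowerSums-odd : ∀ {a} → PosOdd a → exp+1 1ℚ ⋆ altPowerSums a ≗ exp+1 (ℕ→ℚ a)
exp+1-⋆-altPowerSums-odd {a} odd n = begin
  (exp+1 1ℚ ⋆ altPowerSums a) n                     ≡⟨ exp+1-⋆-altPowerSums a n ⟩
  exp 0ℚ n - (- 1ℚ) ^ᵠ a * exp (ℕ→ℚ a) n            ≡⟨ cong (λ s → exp 0ℚ n - s * exp (ℕ→ℚ a) n) ([-1]^ᵠodd≡-1 odd) ⟩
  exp 0ℚ n - (- 1ℚ) * exp (ℕ→ℚ a) n                 ≡⟨ simplify (exp 0ℚ n) (exp (ℕ→ℚ a) n) ⟩
  exp+1 (ℕ→ℚ a) n                                   ∎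
  where
  simplify : ∀ z x → z - (- 1ℚ) * x ≡ x + z
  simplify = solve-∀ ℚ-ring

exp+1≗scaleVar-exp+1 : ∀ c → exp+1 c ≗ scaleVar c (exp+1 1ℚ)
exp+1≗scaleVar-exp+1 c n = sym (trans (scaleVar-exp+1 c 1ℚ n) (cong (λ z → exp+1 z n) (*-identityʳ c)))

scaleVar-genocchiNumber-⋆-exp+1 : ∀ c → scaleVar c genocchiNumber ⋆ exp+1 c ≗ c ·ₚ twoT
scaleVar-genocchiNumber-⋆-exp+1 c n = begin
  (scaleVar c genocchiNumber ⋆ exp+1 c) n                 ≡⟨ ⋆-cong {f = scaleVar c genocchiNumber} (λ _ → refl) (exp+1≗scaleVar-exp+1 c) n ⟩
  (scaleVar c genocchiNumber ⋆ scaleVar c (exp+1 1ℚ)) n   ≡⟨ sym (scaleVar-⋆ c genocchiNumber (exp+1 1ℚ) n) ⟩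
  scaleVar c (genocchiNumber ⋆ exp+1 1ℚ) n                ≡⟨ scaleVar-cong c genocchiNumber-⋆-exp+1 n ⟩
  scaleVar c twoT n                                       ≡⟨ scaleVar-twoT c n ⟩
  c * twoT n                                              ∎

exp+1-⋆-scaleVar-altPowerSums : ∀ c {a} → PosOdd a → exp+1 c ⋆ scaleVar c (altPowerSums a) ≗ exp+1 (c * ℕ→ℚ a)
exp+1-⋆-scaleVar-altPowerSums c {a} odd n = begin
  (exp+1 c ⋆ scaleVar c (altPowerSums a)) n                ≡⟨ ⋆-cong {g = scaleVar c (altPowerSums a)} (exp+1≗scaleVar-exp+1 c) (λ _ → refl) n ⟩
  (scaleVar c (exp+1 1ℚ) ⋆ scaleVar c (altPowerSums a)) n  ≡⟨ sym (scaleVar-⋆ c (exp+1 1ℚ) (altPowerSums a) n) ⟩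
  scaleVar c (exp+1 1ℚ ⋆ altPowerSums a) n                 ≡⟨ scaleVar-cong c (exp+1-⋆-altPowerSums-odd odd) n ⟩
  scaleVar c (exp+1 (ℕ→ℚ a)) n                             ≡⟨ scaleVar-exp+1 c (ℕ→ℚ a) n ⟩
  exp+1 (c * ℕ→ℚ a) n                                      ∎

Φ : ℕ → ℕ → EGF
Φ a b = scaleVar (ℕ→ℚ a) genocchiNumber ⋆ scaleVar (ℕ→ℚ b) (altPowerSums a)

exp+1-⋆-exp+1-⋆-Φ : ∀ {a} b → PosOdd a →
  exp+1 (ℕ→ℚ a) ⋆ (exp+1 (ℕ→ℚ b) ⋆ Φ a b) ≗ ℕ→ℚ a ·ₚ (twoT ⋆ exp+1 (ℕ→ℚ b * ℕ→ℚ a))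
exp+1-⋆-exp+1-⋆-Φ {a} b odd n = begin
  (exp+1 A ⋆ (exp+1 B ⋆ (G ⋆ T))) n     ≡⟨ ⋆-cong {f = exp+1 A} (λ _ → refl) (⋆-exchange (exp+1 B) G T) n ⟩
  (exp+1 A ⋆ (G ⋆ (exp+1 B ⋆ T))) n     ≡⟨ sym (⋆-assoc (exp+1 A) G (exp+1 B ⋆ T) n) ⟩
  ((exp+1 A ⋆ G) ⋆ (exp+1 B ⋆ T)) n     ≡⟨ ⋆-cong (λ k → trans (⋆-comm (exp+1 A) G k) (scaleVar-genocchiNumber-⋆-exp+1 A k))
                                                  (exp+1-⋆-scaleVar-altPowerSums B odd) n ⟩
  ((A ·ₚ twoT) ⋆ exp+1 (B * A)) n       ≡⟨ ⋆-·ₚˡ A twoT (exp+1 (B * A)) n ⟩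
  A * (twoT ⋆ exp+1 (B * A)) n          ∎
  where
  A = ℕ→ℚ a
  B = ℕ→ℚ b
  G = scaleVar A genocchiNumber
  T = scaleVar B (altPowerSums a)

Φ-sym : ∀ {a b} → PosOdd a → PosOdd b → ℕ→ℚ b ·ₚ Φ a b ≗ ℕ→ℚ a ·ₚ Φ b a
Φ-sym {a} {b} odd-a odd-b = exp+1-⋆-cancelˡ B (exp+1-⋆-cancelˡ A λ n → begin
  (exp+1 A ⋆ (exp+1 B ⋆ (B ·ₚ Φ a b))) n     ≡⟨ pull B (exp+1 A) (exp+1 B) (Φ a b) n ⟩
  B * (exp+1 A ⋆ (exp+1 B ⋆ Φ a b)) n        ≡⟨ cong (B *_) (exp+1-⋆-exp+1-⋆-Φ b odd-a n) ⟩
  B * (A * (twoT ⋆ exp+1 (B * A)) n)         ≡⟨ cong (λ c → B * (A * (twoT ⋆ exp+1 c) n)) (*-comm B A) ⟩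
  B * (A * (twoT ⋆ exp+1 (A * B)) n)         ≡⟨ x*[y*z]≡y*[x*z] B A ((twoT ⋆ exp+1 (A * B)) n) ⟩
  A * (B * (twoT ⋆ exp+1 (A * B)) n)         ≡⟨ cong (A *_) (sym (exp+1-⋆-exp+1-⋆-Φ a odd-b n)) ⟩
  A * (exp+1 B ⋆ (exp+1 A ⋆ Φ b a)) n        ≡⟨ cong (A *_) (⋆-exchange (exp+1 B) (exp+1 A) (Φ b a) n) ⟩
  A * (exp+1 A ⋆ (exp+1 B ⋆ Φ b a)) n        ≡⟨ sym (pull A (exp+1 A) (exp+1 B) (Φ b a) n) ⟩
  (exp+1 A ⋆ (exp+1 B ⋆ (A ·ₚ Φ b a))) n     ∎)
  where
  A = ℕ→ℚ a
  B = ℕ→ℚ b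
  pull : ∀ c f g h → f ⋆ (g ⋆ (c ·ₚ h)) ≗ c ·ₚ (f ⋆ (g ⋆ h))
  pull c f g h n = trans (⋆-cong {f = f} (λ _ → refl) (⋆-·ₚʳ c g h) n) (⋆-·ₚʳ c f (g ⋆ h) n)

mono-transpose : ∀ c t j → mono c t j ≡ c * mono 1ℚ j t
mono-transpose c t j with j ℕ.≟ t | t ℕ.≟ j
... | yes _   | yes _   = sym (*-identityʳ c)
... | no _    | no _    = sym (*-zeroʳ c)
... | yes j≡t | no t≢j  = ⊥-elim (t≢j (sym j≡t))
... | no j≢t  | yes t≡j = ⊥-elim (j≢t (sym t≡j))

genocchi≡genocchiNumber-⋆-mono : ∀ i j → genocchi i j ≡ (genocchiNumber ⋆ mono 1ℚ j) i
genocchi≡genocchiNumber-⋆-mono i j = trans (Σₚ<-apply (suc i) _ j)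
  (Σ<-cong (suc i) (λ k _ → mono-transpose (i Cℚ k * genocchiNumber k) (i ∸ k) j))

scaleVar-mono : ∀ c j → scaleVar c (mono 1ℚ j) ≗ (c ^ᵠ j) ·ₚ mono 1ℚ j
scaleVar-mono c j n with n ℕ.≟ j
... | yes refl = refl
... | no _     = trans (*-zeroʳ (c ^ᵠ n)) (sym (*-zeroʳ (c ^ᵠ j)))

scaleVar-genocchiNumber-⋆-mono : ∀ c d i j →
  (scaleVar c genocchiNumber ⋆ scaleVar (c * d) (mono 1ℚ j)) i ≡ c ^ᵠ i * scaleVar d (genocchi i) j
scaleVar-genocchiNumber-⋆-mono c d i j = begin
  (scaleVar c g ⋆ scaleVar (c * d) δ) i           ≡⟨ ⋆-cong {f = scaleVar c g} (λ _ → refl) (λ n → sym (scaleVar-scaleVar c d δ n)) i ⟩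
  (scaleVar c g ⋆ scaleVar c (scaleVar d δ)) i    ≡⟨ sym (scaleVar-⋆ c g (scaleVar d δ) i) ⟩
  c ^ᵠ i * (g ⋆ scaleVar d δ) i                   ≡⟨ cong (c ^ᵠ i *_) (⋆-cong {f = g} (λ _ → refl) (scaleVar-mono d j) i) ⟩
  c ^ᵠ i * (g ⋆ ((d ^ᵠ j) ·ₚ δ)) i                ≡⟨ cong (c ^ᵠ i *_) (⋆-·ₚʳ (d ^ᵠ j) g δ i) ⟩
  c ^ᵠ i * (d ^ᵠ j * (g ⋆ δ) i)                   ≡⟨ cong (λ x → c ^ᵠ i * (d ^ᵠ j * x)) (sym (genocchi≡genocchiNumber-⋆-mono i j)) ⟩
  c ^ᵠ i * (d ^ᵠ j * genocchi i j)                ∎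
  where
  g = genocchiNumber
  δ = mono 1ℚ j

genocchiSide : ℕ → ℕ → ℕ → Poly
genocchiSide a b m = Σₚ< (suc m) (λ i → (ℕ→ℚ (m C i) * powPred a i * (ℕ→ℚ b ^ᵠ (m ∸ i)) * S (m ∸ i) a)
                                         ·ₚ scaleVar (ℕ→ℚ b) (genocchi i))

*-genocchiSide : ∀ a b .{{_ : ℕ.NonZero a}} m j →
  ℕ→ℚ a * genocchiSide a b m j ≡ (scaleVar (ℕ→ℚ a * ℕ→ℚ b) (mono 1ℚ j) ⋆ Φ a b) m
*-genocchiSide a b m j = begin
  A * genocchiSide a b m j                ≡⟨ cong (A *_) (Σₚ<-apply (suc m) F j) ⟩
  A * Σ< (suc m) (λ i → F i j)            ≡⟨ *-distribˡ-Σ< (suc m) A (λ i → F i j) ⟩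
  Σ< (suc m) (λ i → A * F i j)            ≡⟨ Σ<-cong (suc m) (λ i _ → summand i) ⟩
  ((G ⋆ X) ⋆ T) m                         ≡⟨ ⋆-cong {g = T} (⋆-comm G X) (λ _ → refl) m ⟩
  ((X ⋆ G) ⋆ T) m                         ≡⟨ ⋆-assoc X G T m ⟩
  (X ⋆ Φ a b) m                           ∎
  where
  A = ℕ→ℚ a
  B = ℕ→ℚ b
  G = scaleVar A genocchiNumber
  T = scaleVar B (altPowerSums a)
  X = scaleVar (A * B) (mono 1ℚ j)
  F : ℕ → Poly
  F i = (m Cℚ i * powPred a i * B ^ᵠ (m ∸ i) * S (m ∸ i) a) ·ₚ scaleVar B (genocchi i)

  rearrange : ∀ a c p b s y → a * (c * p * b * s * y) ≡ c * ((a * p) * y) * (b * s)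
  rearrange = solve-∀ ℚ-ring

  summand : ∀ i → A * F i j ≡ m Cℚ i * (G ⋆ X) i * T (m ∸ i)
  summand i = begin
    A * F i j                                                           ≡⟨ rearrange A (m Cℚ i) (powPred a i) (B ^ᵠ (m ∸ i)) (S (m ∸ i) a) _ ⟩
    m Cℚ i * ((A * powPred a i) * scaleVar B (genocchi i) j) * T (m ∸ i) ≡⟨ cong (λ x → m Cℚ i * (x * scaleVar B (genocchi i) j) * T (m ∸ i)) (*-powPred a i) ⟩
    m Cℚ i * (A ^ᵠ i * scaleVar B (genocchi i) j) * T (m ∸ i)           ≡⟨ cong (λ x → m Cℚ i * x * T (m ∸ i)) (sym (scaleVar-genocchiNumber-⋆-mono A B i j)) ⟩
    m Cℚ i * (G ⋆ X) i * T (m ∸ i)                                      ∎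

posOdd⇒nonZero : ∀ {a} → PosOdd a → ℕ.NonZero a
posOdd⇒nonZero (k , refl) = _

corollary2p6 : (a b : ℕ) → PosOdd a → PosOdd b → (m : ℕ) → (j : ℕ) →
    Σₚ< (suc m) (λ i → (ℕ→ℚ (m C i) * powPred a i * (ℕ→ℚ b ^ᵠ (m ∸ i)) * S (m ∸ i) a)
                         ·ₚ scaleVar (ℕ→ℚ b) (genocchi i)) j
      ≡ Σₚ< (suc m) (λ i → (ℕ→ℚ (m C i) * powPred b i * (ℕ→ℚ a ^ᵠ (m ∸ i)) * S (m ∸ i) b)
                         ·ₚ scaleVar (ℕ→ℚ a) (genocchi i)) j
corollary2p6 a b odd-a odd-b m j =
  ℕ→ℚ-*-cancelˡ a L R (ℕ→ℚ-*-cancelˡ b (A * L) (A * R) (begin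
    B * (A * L)                         ≡⟨ cong (B *_) (*-genocchiSide a b m j) ⟩
    B * (X (A * B) ⋆ Φ a b) m           ≡⟨ sym (⋆-·ₚʳ B (X (A * B)) (Φ a b) m) ⟩
    (X (A * B) ⋆ (B ·ₚ Φ a b)) m        ≡⟨ ⋆-cong {f = X (A * B)} (λ _ → refl) (Φ-sym odd-a odd-b) m ⟩
    (X (A * B) ⋆ (A ·ₚ Φ b a)) m        ≡⟨ ⋆-·ₚʳ A (X (A * B)) (Φ b a) m ⟩
    A * (X (A * B) ⋆ Φ b a) m           ≡⟨ cong (λ c → A * (X c ⋆ Φ b a) m) (*-comm A B) ⟩
    A * (X (B * A) ⋆ Φ b a) m           ≡⟨ cong (A *_) (sym (*-genocchiSide b a m j)) ⟩
    A * (B * R)                         ≡⟨ x*[y*z]≡y*[x*z] A B R ⟩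
    B * (A * R)                         ∎))
  where
  instance
    _ = posOdd⇒nonZero odd-a
    _ = posOdd⇒nonZero odd-b
  A = ℕ→ℚ a
  B = ℕ→ℚ b
  L = genocchiSide a b m j
  R = genocchiSide b a m j
  X : ℚ → EGF
  X c = scaleVar c (mono 1ℚ j)
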